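{- The category $\mathbf{CIS}$ is a full reflective subcategory of $\mathbf{SCIS}$.
   Context: A simplified continuous information system is a triple $(S,\mathrm{CON},\Vdash)$ with $S$ a set, $\mathrm{CON}$ a collection of finite subsets of $S$ and $\Vdash\subseteq\mathrm{CON}\times S$, such that for all $X,Y\in\mathrm{CON}$, $a\in S$ and finite $F\subseteq S$ (writing $X\Vdash Y$ iff $X\Vdash b$ for all $b\in Y$): (1) $\{a\}\in\mathrm{CON}$; (2) if $X\subseteq Y$ and $X\Vdash a$ then $Y\Vdash a$; (3) if $X\Vdash Y$ and $Y\Vdash a$ then $X\Vdash a$; (4) if $X\Vdash a$ then there is $Z\in\mathrm{CON}$ with $X\Vdash Z$ and $Z\Vdash a$; (5) if $X\Vdash F$ then there is $Z\in\mathrm{CON}$ with $F\subseteq Z$ and $X\Vdash Z$. It is a continuous information system if moreover $X\Vdash a$ implies $X\cup\{a\}\in\mathrm{CON}$. An approximable mapping $H$ from $(S,\mathrm{CON},\Vdash)$ to $(S',\mathrm{CON}',\Vdash')$ is a relation $H\subseteq\mathrm{CON}\times S'$ (write $XHF$ iff $XHb$ for all $b\in F$) such that for all $X,X'\in\mathrm{CON}$, $Y\in\mathrm{CON}'$, $b\in S'$ and finite $F\subseteq S'$: (a) $XHY$ and $Y\Vdash' b$ imply $XHb$; (b) $X\supseteq X'$ and $X'Hb$ imply $XHb$; (c) $X\Vdash X'$ and $X'Hb$ imply $XHb$; (d) if $XHb$ there are $Z\in\mathrm{CON}$, $Z'\in\mathrm{CON}'$ with $X\Vdash Z$, $ZHZ'$,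 $Z'\Vdash' b$; (e) if $XHF$ there is $Z\in\mathrm{CON}'$ with $F\subseteq Z$ and $XHZ$. $\mathbf{SCIS}$ is the category of simplified continuous information systems and approximable mappings (composition = relational composition, identity on $\mathbb S$ = its $\Vdash$); $\mathbf{CIS}$ is its full subcategory of continuous information systems. -}

module Defs where

open import Level using (0ℓ)
open import Data.List using (List; []; _∷_; [_])
open import Data.List.Relation.Unary.All using (All)
open import Data.List.Relation.Binary.Subset.Propositional using (_⊆_)
open import Data.Product using (Σ; _×_; _,_)

-- Finite subsets of S are represented by lists of elements of S, read up
-- to having the same elements (membership-based inclusion _⊆_).

record SCIS : Set₁ where
  field
    S    : Set
    Con  : List S → Set
    _⊩_  : List S → S → Set
  _⊩*_ : List S → List S → Set
  X ⊩* Y = All (X ⊩_) Y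
  field
    -- CON is a collection of finite subsets: respects list-as-set equality
    Con-resp : ∀ {X Y} → X ⊆ Y → Y ⊆ X → Con X → Con Y
    ⊩-Con    : ∀ {X a} → X ⊩ a → Con X
    Con-single : ∀ a → Con [ a ]
    ⊩-mono   : ∀ {X Y a} → Con X → Con Y → X ⊆ Y → X ⊩ a → Y ⊩ a
    ⊩-trans  : ∀ {X Y a} → Con X → Con Y → X ⊩* Y → Y ⊩ a → X ⊩ a
    ⊩-interp : ∀ {X a} → Con X → X ⊩ a →
               Σ (List S) λ Z → Con Z × X ⊩* Z × Z ⊩ a
    ⊩-fin    : ∀ {X} (F : List S) → Con X → X ⊩* F →
               Σ (List S) λ Z → Con Z × F ⊆ Z × X ⊩* Z

open SCIS public

IsCIS : SCIS → Set
IsCIS A = ∀ {X a} → _⊩_ A X a → Con A (a ∷ X)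

record Hom (A B : SCIS) : Set₁ where
  field
    H : List (S A) → S B → Set
  _H*_ : List (S A) → List (S B) → Set
  X H* Y = All (H X) Y
  field
    H-Con : ∀ {X b} → H X b → Con A X
    H-a : ∀ {X Y b} → Con A X → Con B Y → X H* Y → _⊩_ B Y b → H X b
    H-b : ∀ {X X' b} → Con A X → Con A X' → X' ⊆ X → H X' b → H X b
    H-c : ∀ {X X' b} → Con A X → Con A X' → _⊩*_ A X X' → H X' b → H X b
    H-d : ∀ {X b} → H X b →
          Σ (List (S A)) λ Z → Σ (List (S B)) λ Z' →
            Con A Z × Con B Z' × _⊩*_ A X Z × Z H* Z' × _⊩_ B Z' b
    H-e : ∀ {X} (F : List (S B)) → Con A X → X H* F →
          Σ (List (S B)) λ Z → Con B Z × F ⊆ Z × X H* Z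

open Hom public

_∘R_ : {A B C : SCIS} → Hom B C → Hom A B → List (S A) → S C → Set
_∘R_ {A} {B} G F X c =
  Con A X × Σ (List (S B)) λ Y → Con B Y × All (H F X) Y × H G Y c

_≈R_ : {A B : SCIS} → (List (S A) → S B → Set) → (List (S A) → S B → Set) → Set
R ≈R R' = ∀ X b → (R X b → R' X b) × (R' X b → R X b)

HasReflection : SCIS → Set₁
HasReflection A =
  Σ SCIS λ R → IsCIS R × Σ (Hom A R) λ η →
    ∀ (B : SCIS) → IsCIS B → (f : Hom A B) →
      Σ (Hom R B) λ g →
        (_≈R_ {A} {B} (_∘R_ {A} {R} {B} g η) (H f)) ×
        (∀ (g' : Hom R B) → _≈R_ {A} {B} (_∘R_ {A} {R} {B} g' η) (H f) →
           _≈R_ {R} {B} (H g') (H g))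

{-# OPTIONS --safe #-}
module Submission where

-- The reflection of A has as tokens the consistent sets of A, preordered by
-- inclusion of what they entail (u ⊑ v).  A finite set of tokens is consistent
-- when it has a ⊑-greatest member, and it entails v when v ≪ u for a member u,
-- where v ≪ u means v ⊑ W for some W entailed by u.  Since v ≪ u implies
-- v ⊑ u, adjoining an entailed token keeps the greatest member: this is the
-- extra CIS axiom.  The unit relates X to the tokens way below X, and an
-- approximable f out of A extends by letting a consistent family of tokens
-- relate to c when one of its members does; interpolation in A gives both the
-- factorisation and its uniqueness.

open import Data.List using (List; []; _∷_; [_]; _++_)
open import Data.List.Membership.Propositional using (_∈_)
open import Data.List.Membership.Propositional.Properties using (∈-++⁺ˡ; ∈-++⁺ʳ)
open import Data.List.Relation.Binary.Subset.Propositional using (_⊆_)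
open import Data.List.Relation.Unary.All as All using (All; []; _∷_)
open import Data.List.Relation.Unary.All.Properties using (++⁺)
open import Data.List.Relation.Unary.Any using (here; there)
open import Data.Product using (Σ; ∃-syntax; _×_; _,_; proj₁; proj₂)
open import Relation.Binary.PropositionalEquality using (refl)

open import Defs using (SCIS; IsCIS; Hom; _∘R_; _≈R_; HasReflection)

module Entailment (A : SCIS) where
  open SCIS A

  _⊑_ : List S → List S → Set
  X ⊑ Y = ∀ {b} → X ⊩ b → Y ⊩ b

  ⊑-refl : ∀ {X} → X ⊑ X
  ⊑-refl Xb = Xb

  ⊑-trans : ∀ {X Y Z} → X ⊑ Y → Y ⊑ Z → X ⊑ Z
  ⊑-trans X⊑Y Y⊑Z Xb = Y⊑Z (X⊑Y Xb)

  ⊆⇒⊑ : ∀ {X Y} → Con Y → X ⊆ Y → X ⊑ Y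
  ⊆⇒⊑ cY X⊆Y Xb = ⊩-mono (⊩-Con Xb) cY X⊆Y Xb

  ⊩*⇒⊑ : ∀ {X Y} → Con X → X ⊩* Y → Y ⊑ X
  ⊩*⇒⊑ cX XY Yb = ⊩-trans cX (⊩-Con Yb) XY Yb

  ⊩*-directed : ∀ {X Y₁ Y₂} → Con X → X ⊩* Y₁ → X ⊩* Y₂ →
                ∃[ Z ] Con Z × X ⊩* Z × Y₁ ⊑ Z × Y₂ ⊑ Z
  ⊩*-directed {Y₁ = Y₁} {Y₂} cX XY₁ XY₂ with ⊩-fin (Y₁ ++ Y₂) cX (++⁺ XY₁ XY₂)
  ... | Z , cZ , Y₁₂⊆Z , XZ =
    Z , cZ , XZ , ⊆⇒⊑ cZ (λ p → Y₁₂⊆Z (∈-++⁺ˡ p)) , ⊆⇒⊑ cZ (λ p → Y₁₂⊆Z (∈-++⁺ʳ Y₁ p))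

  ⊩*-interpolate : ∀ {X} (Y : List S) → Con X → X ⊩* Y →
                   ∃[ Z ] Con Z × X ⊩* Z × Z ⊩* Y
  ⊩*-interpolate [] cX [] with ⊩-fin [] cX []
  ... | Z , cZ , _ , XZ = Z , cZ , XZ , []
  ⊩*-interpolate (y ∷ Y) cX (Xy ∷ XY) with ⊩-interp cX Xy | ⊩*-interpolate Y cX XY
  ... | Z₁ , _ , XZ₁ , Z₁y | Z₂ , _ , XZ₂ , Z₂Y with ⊩*-directed cX XZ₁ XZ₂
  ... | Z , cZ , XZ , Z₁⊑Z , Z₂⊑Z = Z , cZ , XZ , Z₁⊑Z Z₁y ∷ All.map Z₂⊑Z Z₂Y

  _≪_ : List S → List S → Set
  Y ≪ X = ∃[ W ] Con W × X ⊩* W × Y ⊑ W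

  ⊩*⇒≪ : ∀ {X Y} → Con Y → X ⊩* Y → Y ≪ X
  ⊩*⇒≪ cY XY = _ , cY , XY , ⊑-refl

  ≪⇒⊑ : ∀ {X Y} → Con X → Y ≪ X → Y ⊑ X
  ≪⇒⊑ cX (_ , _ , XW , Y⊑W) = ⊑-trans Y⊑W (⊩*⇒⊑ cX XW)

  ≪-⊑-trans : ∀ {X X′ Y} → Y ≪ X → X ⊑ X′ → Y ≪ X′
  ≪-⊑-trans (W , cW , XW , Y⊑W) X⊑X′ = W , cW , All.map X⊑X′ XW , Y⊑W

  ≪-trans : ∀ {X Y Z} → Z ≪ Y → Y ≪ X → Z ≪ X
  ≪-trans (_ , _ , YW₁ , Z⊑W₁) (W₂ , cW₂ , XW₂ , Y⊑W₂) =
    W₂ , cW₂ , XW₂ , ⊑-trans Z⊑W₁ (⊩*⇒⊑ cW₂ (All.map Y⊑W₂ YW₁))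

  ≪-interpolate : ∀ {X Y} → Con X → Y ≪ X → ∃[ Z ] Con Z × X ⊩* Z × Y ≪ Z
  ≪-interpolate cX (W , cW , XW , Y⊑W) with ⊩*-interpolate W cX XW
  ... | Z , cZ , XZ , ZW = Z , cZ , XZ , (W , cW , ZW , Y⊑W)

  Token : Set
  Token = Σ (List S) Con

  ⌊_⌋ : Token → List S
  ⌊_⌋ = proj₁

  ≪-upper-bound : ∀ {F} (t : Token) → All (λ u → ⌊ u ⌋ ≪ ⌊ t ⌋) F →
                  ∃[ Z ] Con Z × ⌊ t ⌋ ⊩* Z × (∀ {u} → u ∈ F → ⌊ u ⌋ ⊑ Z)
  ≪-upper-bound (_ , ct) [] with ⊩-fin [] ct []
  ... | Z , cZ , _ , tZ = Z , cZ , tZ , λ ()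
  ≪-upper-bound t@(_ , ct) ((_ , _ , tW , u⊑W) ∷ F≪t) with ≪-upper-bound t F≪t
  ... | Z₁ , _ , tZ₁ , F⊑Z₁ with ⊩*-directed ct tW tZ₁
  ... | Z , cZ , tZ , W⊑Z , Z₁⊑Z =
    Z , cZ , tZ , λ { (here refl) → ⊑-trans u⊑W W⊑Z ; (there v∈F) → ⊑-trans (F⊑Z₁ v∈F) Z₁⊑Z }

module Approximable {A B : SCIS} (f : Hom A B) where
  open SCIS A
  open Entailment A
  open Hom f

  H-interpolate : ∀ {X c} → H X c → ∃[ Z ] Con Z × X ⊩* Z × H Z c
  H-interpolate Xc with H-d Xc
  ... | Z , _ , cZ , cZ′ , XZ , ZZ′ , Z′c = Z , cZ , XZ , H-a cZ cZ′ ZZ′ Z′c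

  H-mono-⊑ : ∀ {X Y c} → Con Y → X ⊑ Y → H X c → H Y c
  H-mono-⊑ cY X⊑Y Xc with H-interpolate Xc
  ... | Z , cZ , XZ , Zc = H-c cY cZ (All.map X⊑Y XZ) Zc

module Reflection (A : SCIS) where
  open SCIS A
  open Entailment A

  record Bounded (X : List Token) : Set where
    constructor bounded
    field
      top  : Token
      top∈ : top ∈ X
      ⊑top : ∀ {u} → u ∈ X → ⌊ u ⌋ ⊑ ⌊ top ⌋
  open Bounded

  singleton-bounded : (u : Token) → Bounded [ u ]
  singleton-bounded u = bounded u (here refl) λ { (here refl) → ⊑-refl ; (there ()) }

  adjoin-top : ∀ {F} (t : Token) → All (λ u → ⌊ u ⌋ ≪ ⌊ t ⌋) F →
               ∃[ z ] ⌊ t ⌋ ⊩* ⌊ z ⌋ × Bounded (z ∷ F)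
  adjoin-top t F≪t with ≪-upper-bound t F≪t
  ... | Z , cZ , tZ , F⊑Z = (Z , cZ) , tZ , bounded (Z , cZ) (here refl)
    λ { (here refl) → ⊑-refl ; (there u∈F) → F⊑Z u∈F }

  _⊩ᴿ_ : List Token → Token → Set
  X ⊩ᴿ v = Bounded X × ∃[ u ] u ∈ X × ⌊ v ⌋ ≪ ⌊ u ⌋

  _⊩ᴿ*_ : List Token → List Token → Set
  X ⊩ᴿ* Y = All (X ⊩ᴿ_) Y

  ⊩ᴿ⇒≪top : ∀ {X v} (b : Bounded X) → X ⊩ᴿ v → ⌊ v ⌋ ≪ ⌊ top b ⌋
  ⊩ᴿ⇒≪top b (_ , u , u∈X , v≪u) = ≪-⊑-trans v≪u (⊑top b u∈X)

  ⊩ᴿ-trans : ∀ {X Y v} → Bounded X → Bounded Y → X ⊩ᴿ* Y → Y ⊩ᴿ v → X ⊩ᴿ v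
  ⊩ᴿ-trans bX _ XY (_ , u , u∈Y , v≪u) with All.lookup XY u∈Y
  ... | _ , w , w∈X , u≪w = bX , w , w∈X , ≪-trans v≪u u≪w

  ⊩ᴿ-interp : ∀ {X v} → Bounded X → X ⊩ᴿ v →
              ∃[ Z ] Bounded Z × X ⊩ᴿ* Z × Z ⊩ᴿ v
  ⊩ᴿ-interp bX (_ , u , u∈X , v≪u) with ≪-interpolate (proj₂ u) v≪u
  ... | Z , cZ , uZ , v≪Z =
    [ (Z , cZ) ] , singleton-bounded _ , (bX , u , u∈X , ⊩*⇒≪ cZ uZ) ∷ [] ,
    (singleton-bounded _ , _ , here refl , v≪Z)

  ⊩ᴿ-fin : ∀ {X} (F : List Token) → Bounded X → X ⊩ᴿ* F →
           ∃[ Z ] Bounded Z × F ⊆ Z × X ⊩ᴿ* Z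
  ⊩ᴿ-fin F bX XF with adjoin-top (top bX) (All.map (λ {u} → ⊩ᴿ⇒≪top {v = u} bX) XF)
  ... | z , tz , bz = z ∷ F , bz , there , (bX , top bX , top∈ bX , ⊩*⇒≪ (proj₂ z) tz) ∷ XF

  R : SCIS
  R = record
    { S          = Token
    ; Con        = Bounded
    ; _⊩_        = _⊩ᴿ_
    ; Con-resp   = λ { X⊆Y Y⊆X (bounded t t∈X ⊑t) → bounded t (X⊆Y t∈X) (λ u∈Y → ⊑t (Y⊆X u∈Y)) }
    ; ⊩-Con      = proj₁
    ; Con-single = singleton-bounded
    ; ⊩-mono     = λ { _ bY X⊆Y (_ , u , u∈X , v≪u) → bY , u , X⊆Y u∈X , v≪u }
    ; ⊩-trans    = λ {X} {Y} {v} → ⊩ᴿ-trans {X} {Y} {v}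
    ; ⊩-interp   = λ {X} {v} → ⊩ᴿ-interp {X} {v}
    ; ⊩-fin      = ⊩ᴿ-fin
    }

  R-isCIS : IsCIS R
  R-isCIS (b , u , u∈X , v≪u) = bounded (top b) (there (top∈ b)) λ
    { (here refl) → ≪⇒⊑ (proj₂ (top b)) (≪-⊑-trans v≪u (⊑top b u∈X))
    ; (there w∈X) → ⊑top b w∈X
    }

  Unit : List S → Token → Set
  Unit X v = Con X × ⌊ v ⌋ ≪ X

  Unit-interp : ∀ {X v} → Unit X v →
                ∃[ Z ] ∃[ Z′ ] Con Z × Bounded Z′ × X ⊩* Z × All (Unit Z) Z′ × Z′ ⊩ᴿ v
  Unit-interp (cX , v≪X) with ≪-interpolate cX v≪X
  ... | Y , cY , XY , v≪Y with ≪-interpolate cX (⊩*⇒≪ cY XY)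
  ... | Z , cZ , XZ , Y≪Z =
    Z , [ (Y , cY) ] , cZ , singleton-bounded _ , XZ , (cZ , Y≪Z) ∷ [] ,
    (singleton-bounded _ , _ , here refl , v≪Y)

  Unit-fin : ∀ {X} (F : List Token) → Con X → All (Unit X) F →
             ∃[ Z ] Bounded Z × F ⊆ Z × All (Unit X) Z
  Unit-fin {X} F cX XF with adjoin-top (X , cX) (All.map proj₂ XF)
  ... | z , Xz , bz = z ∷ F , bz , there , (cX , ⊩*⇒≪ (proj₂ z) Xz) ∷ XF

  unit : Hom A R
  unit = record
    { H     = Unit
    ; H-Con = proj₁
    ; H-a   = λ { cX _ XY (_ , u , u∈Y , v≪u) → cX , ≪-trans v≪u (proj₂ (All.lookup XY u∈Y)) }
    ; H-b   = λ { cX _ X′⊆X (_ , v≪X′) → cX , ≪-⊑-trans v≪X′ (⊆⇒⊑ cX X′⊆X) }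
    ; H-c   = λ { cX _ XX′ (_ , v≪X′) → cX , ≪-⊑-trans v≪X′ (⊩*⇒⊑ cX XX′) }
    ; H-d   = λ {X} {v} → Unit-interp {X} {v}
    ; H-e   = Unit-fin
    }

  module Extension (B : SCIS) (f : Hom A B) where
    module B = SCIS B
    open Hom f
    open Approximable f

    Ext : List Token → B.S → Set
    Ext X c = Bounded X × ∃[ u ] u ∈ X × H ⌊ u ⌋ c

    Ext⇒top : ∀ {X c} (b : Bounded X) → Ext X c → H ⌊ top b ⌋ c
    Ext⇒top b (_ , u , u∈X , uc) = H-mono-⊑ (proj₂ (top b)) (⊑top b u∈X) uc

    Ext-c : ∀ {X X′ c} → Bounded X → Bounded X′ → X ⊩ᴿ* X′ → Ext X′ c → Ext X c
    Ext-c bX _ XX′ (_ , u , u∈X′ , uc) with All.lookup XX′ u∈X′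
    ... | _ , w , w∈X , u≪w = bX , w , w∈X , H-mono-⊑ (proj₂ w) (≪⇒⊑ (proj₂ w) u≪w) uc

    Ext-interp : ∀ {X c} → Ext X c →
                 ∃[ Z ] ∃[ Z′ ] Bounded Z × B.Con Z′ × X ⊩ᴿ* Z × All (Ext Z) Z′ × Z′ B.⊩ c
    Ext-interp (bX , u , u∈X , uc) with H-d uc
    ... | Z , Z′ , cZ , cZ′ , uZ , ZZ′ , Z′c =
      [ (Z , cZ) ] , Z′ , singleton-bounded _ , cZ′ , (bX , u , u∈X , ⊩*⇒≪ cZ uZ) ∷ [] ,
      All.map (λ Zc → singleton-bounded _ , _ , here refl , Zc) ZZ′ , Z′c

    Ext-fin : ∀ {X} (F : List B.S) → Bounded X → All (Ext X) F →
              ∃[ Z ] B.Con Z × F ⊆ Z × All (Ext X) Z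
    Ext-fin F bX XF with H-e F (proj₂ (top bX)) (All.map (Ext⇒top bX) XF)
    ... | Z , cZ , F⊆Z , tZ = Z , cZ , F⊆Z , All.map (λ tc → bX , top bX , top∈ bX , tc) tZ

    extend : Hom R B
    extend = record
      { H     = Ext
      ; H-Con = proj₁
      ; H-a   = λ bX cY XY Yc →
                  bX , top bX , top∈ bX , H-a (proj₂ (top bX)) cY (All.map (Ext⇒top bX) XY) Yc
      ; H-b   = λ { bX _ X′⊆X (_ , u , u∈X′ , uc) → bX , u , X′⊆X u∈X′ , uc }
      ; H-c   = Ext-c
      ; H-d   = Ext-interp
      ; H-e   = Ext-fin
      }

    extend∘unit≈f : _≈R_ {A} {B} (_∘R_ {A} {R} {B} extend unit) H
    extend∘unit≈f X c = to , from
      where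
      to : _∘R_ {A} {R} {B} extend unit X c → H X c
      to (cX , _ , _ , XY , (_ , u , u∈Y , uc)) =
        H-mono-⊑ cX (≪⇒⊑ cX (proj₂ (All.lookup XY u∈Y))) uc
      from : H X c → _∘R_ {A} {R} {B} extend unit X c
      from Xc with H-interpolate Xc
      ... | Z , cZ , XZ , Zc =
        H-Con Xc , [ (Z , cZ) ] , singleton-bounded _ , (H-Con Xc , ⊩*⇒≪ cZ XZ) ∷ [] ,
        (singleton-bounded _ , _ , here refl , Zc)

    extend-unique : (g : Hom R B) → _≈R_ {A} {B} (_∘R_ {A} {R} {B} g unit) H →
                    _≈R_ {R} {B} (Hom.H g) Ext
    extend-unique g g∘unit≈f X c = to , from
      where
      module g = Hom g
      to : g.H X c → Ext X c
      to Xc with g.H-Con Xc | Approximable.H-interpolate g Xc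
      ... | bX | Z , bZ , XZ , Zc
        with ≪-upper-bound (top bX) (All.map (λ {u} → ⊩ᴿ⇒≪top {v = u} bX) XZ)
      ... | W , cW , tW , Z⊑W with ⊩*-interpolate W (proj₂ (top bX)) tW
      ... | U , cU , tU , UW =
        bX , top bX , top∈ bX ,
        H-c (proj₂ (top bX)) cU tU (proj₁ (g∘unit≈f U c)
          (cU , Z , bZ , All.tabulate (λ z∈Z → cU , (W , cW , UW , Z⊑W z∈Z)) , Zc))
      from : Ext X c → g.H X c
      from (bX , u , u∈X , uc) with proj₂ (g∘unit≈f ⌊ u ⌋ c) uc
      ... | _ , Y , bY , uY , Yc =
        g.H-c bX bY (All.map (λ uy → bX , u , u∈X , proj₂ uy) uY) Yc

theorem4p33 : (A : SCIS) → HasReflection A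
theorem4p33 A = R , R-isCIS , unit , λ B _ f →
  let open Extension B f in extend , extend∘unit≈f , extend-unique
  where open Reflection A
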